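{- Let $n\geq 4$. The poset $(\mathcal{C}_{n-2,1,1},\leq)$ (equivalently its Hasse diagram) is graded with rank function $\rho(\tau)=\ell({}_{\tau}w)$ for every $\tau\in\mathcal{C}_{n-2,1,1}$, where ${}_{\tau}w$ is the row reading of $\tau$; moreover the rank of $\mathcal{C}_{n-2,1,1}$ is $2(n-2)$.
   Context: A recording row-strict tableau of shape $(n-2,1,1)$ is a filling of the Young diagram with rows of lengths $n-2,1,1$ (top to bottom) by $1,\dots,n$, each used once, with first row $m_1<\dots<m_{n-2}$, second row entry $b_1$ and third row entry $b_2$ with $b_1>b_2$; $\mathcal{C}_{n-2,1,1}$ is the set of these. For $\tau=(m_1,\dots,m_{n-2};b_1;b_2)$, $\tau'=(m'_1,\dots,m'_{n-2};b'_1;b'_2)$: $\tau\leq\tau'$ iff $m_i\geq m'_i$ for all $i$, $b_1\leq b'_1$ and $b_2\leq b'_2$. The row reading is ${}_{\tau}w=[b_2,b_1,m_1,\dots,m_{n-2}]\in\mathfrak{S}_n$ (one-line notation). $\ell$ is the number of inversions. Graded with rank function $\rho$ means $\rho$ takes value $0$ at the minimum element and $\rho(\tau')=\rho(\tau)+1$ whenever $\tau'$ covers $\tau$; the rank of the poset is the maximal value of $\rho$. -}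

module Defs where

open import Data.Nat using (ℕ; zero; suc; _+_; _*_; _∸_; _≤_; _<_; _≥_; _<?_)
open import Data.List using (List; []; _∷_; length; filter; map; upTo)
open import Data.Vec using (Vec; toList)
open import Data.Vec.Relation.Binary.Pointwise.Inductive using (Pointwise)
open import Data.List.Relation.Unary.Linked using (Linked)
open import Data.List.Relation.Binary.Permutation.Propositional using (_↭_)
open import Data.Product using (Σ; _×_; ∃)
open import Relation.Binary.PropositionalEquality using (_≡_)
open import Relation.Nullary using (¬_)

-- A (candidate) filling of the Young diagram of shape (n-2,1,1):
-- first row m = (m₁,…,m_{n-2}), second row b₁, third row b₂.
record Filling (n : ℕ) : Set where
  constructor mkFilling
  field
    row : Vec ℕ (n ∸ 2)
    b₁  : ℕ
    b₂  : ℕ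
open Filling public

rowReading : ∀ {n} → Filling n → List ℕ
rowReading τ = b₂ τ ∷ b₁ τ ∷ toList (row τ)

IsRST : (n : ℕ) → Filling n → Set
IsRST n τ =
  (rowReading τ ↭ map suc (upTo n)) ×
  Linked _<_ (toList (row τ)) ×
  b₂ τ < b₁ τ

inv : List ℕ → ℕ
inv []       = 0
inv (x ∷ xs) = length (filter (_<? x) xs) + inv xs

_⊑_ : ∀ {n} → Filling n → Filling n → Set
τ ⊑ τ' = Pointwise _≥_ (row τ) (row τ') × b₁ τ ≤ b₁ τ' × b₂ τ ≤ b₂ τ'

_⊏_ : ∀ {n} → Filling n → Filling n → Set
τ ⊏ τ' = τ ⊑ τ' × ¬ (τ ≡ τ')

Covers : (n : ℕ) → Filling n → Filling n → Set
Covers n τ τ' = τ ⊏ τ' × ¬ (Σ (Filling n) λ σ → IsRST n σ × τ ⊏ σ × σ ⊏ τ')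

ρ : ∀ {n} → Filling n → ℕ
ρ τ = inv (rowReading τ)

-- The first row of a tableau lists the values other than b₂ < b₁ in
-- increasing order, and its reading has ρ = (b₂ − 1) + (b₁ − 2) inversions.
-- Counting the values below each bound shows that τ ≤ τ' exactly when
-- b₂ ≤ b′₂ and b₁ ≤ b′₁, so the poset is that of the pairs
-- 1 ≤ b₂ < b₁ ≤ n ordered componentwise.  A cover raises one entry by one,
-- hence raises ρ by one, and ρ runs from 0 at (1, 2) to 2(n − 2) at (n − 1, n).
module Submission where

open import Defs
open import Data.Nat using (ℕ; zero; suc; _≤_; _<_; _≥_; _+_; _*_; _∸_; _<?_; _≟_; z≤n; s≤s; s≤s⁻¹)
open import Data.Nat.Properties
open import Data.Nat.Tactic.RingSolver using (solve-∀)
open import Data.List using (List; []; _∷_; [_]; _++_; length; filter; map; upTo; applyUpTo)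
import Data.List.Properties as List
open import Data.List.Membership.Propositional using (_∈_)
open import Data.List.Relation.Unary.Any using (here; there)
open import Data.List.Relation.Unary.All as All using (All; []; _∷_)
open import Data.List.Relation.Unary.AllPairs using (AllPairs; []; _∷_)
open import Data.List.Relation.Unary.Linked using (Linked; []; [-]; _∷_)
open import Data.List.Relation.Unary.Linked.Properties using (Linked⇒AllPairs; AllPairs⇒Linked)
open import Data.List.Relation.Binary.Pointwise as List using ([]; _∷_)
open import Data.List.Relation.Binary.Sublist.Propositional using (_⊆_; []; _∷_; _∷ʳ_; ⊆-refl)
open import Data.List.Relation.Binary.Sublist.Propositional.Properties using (All-resp-⊆; ++⁺)
open import Data.List.Relation.Binary.Permutation.Propositional
  using (_↭_; prep; ↭-sym; ↭-trans; ↭-reflexive; module PermutationReasoning)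
open import Data.List.Relation.Binary.Permutation.Propositional.Properties
  using (shift; ++⁺ˡ; filter-↭; ↭-length; ∈-resp-↭)
open import Data.Vec using (Vec; toList; []; _∷_)
import Data.Vec as Vec
import Data.Vec.Properties as Vec
open import Data.Vec.Relation.Binary.Pointwise.Inductive using (Pointwise; []; _∷_)
open import Data.Product using (Σ; _×_; _,_; proj₁; proj₂)
open import Data.Sum using (inj₁; inj₂)
open import Data.Empty using (⊥-elim)
open import Relation.Binary.Core using (Rel)
open import Relation.Nullary using (¬_; yes; no)
open import Relation.Nullary.Decidable using (decidable-stable)
open import Relation.Binary.PropositionalEquality using (_≡_; refl; sym; trans; cong; cong₂; subst; subst₂; module ≡-Reasoning)

countBelow : ℕ → List ℕ → ℕ
countBelow x xs = length (filter (_<? x) xs)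

module _ {x y : ℕ} {ys : List ℕ} where

  countBelow-∷-< : y < x → countBelow x (y ∷ ys) ≡ suc (countBelow x ys)
  countBelow-∷-< y<x = cong length (List.filter-accept (_<? x) y<x)

  countBelow-∷-≮ : ¬ y < x → countBelow x (y ∷ ys) ≡ countBelow x ys
  countBelow-∷-≮ y≮x = cong length (List.filter-reject (_<? x) y≮x)

countBelow-++ : ∀ x xs ys → countBelow x (xs ++ ys) ≡ countBelow x xs + countBelow x ys
countBelow-++ x xs ys =
  trans (cong length (List.filter-++ (_<? x) xs ys)) (List.length-++ (filter (_<? x) xs))

countBelow-↭ : ∀ {x xs ys} → xs ↭ ys → countBelow x xs ≡ countBelow x ys
countBelow-↭ {x} xs↭ys = ↭-length (filter-↭ (_<? x) xs↭ys)

countBelow-≥ : ∀ {x xs} → All (x ≤_) xs → countBelow x xs ≡ 0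
countBelow-≥ []         = refl
countBelow-≥ (x≤y ∷ ps) = trans (countBelow-∷-≮ (≤⇒≯ x≤y)) (countBelow-≥ ps)

countBelow-antitone : ∀ {x xs ys} → List.Pointwise _≤_ xs ys → countBelow x ys ≤ countBelow x xs
countBelow-antitone []                  = z≤n
countBelow-antitone {x} {y ∷ xs} {y' ∷ ys} (y≤y' ∷ xs≤ys) with y' <? x | y <? x
... | yes y'<x | yes y<x
  rewrite countBelow-∷-< {ys = ys} y'<x | countBelow-∷-< {ys = xs} y<x = s≤s (countBelow-antitone xs≤ys)
... | yes y'<x | no y≮x  = ⊥-elim (y≮x (≤-<-trans y≤y' y'<x))
... | no  y'≮x | yes y<x
  rewrite countBelow-∷-≮ {ys = ys} y'≮x | countBelow-∷-< {ys = xs} y<x = m≤n⇒m≤1+n (countBelow-antitone xs≤ys)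
... | no  y'≮x | no y≮x
  rewrite countBelow-∷-≮ {ys = ys} y'≮x | countBelow-∷-≮ {ys = xs} y≮x = countBelow-antitone xs≤ys

inv-increasing : ∀ {xs} → AllPairs _<_ xs → inv xs ≡ 0
inv-increasing []            = refl
inv-increasing (x<xs ∷ incr) = cong₂ _+_ (countBelow-≥ (All.map <⇒≤ x<xs)) (inv-increasing incr)

AllPairs-resp-⊆ : ∀ {a ℓ} {A : Set a} {R : Rel A ℓ} {xs ys : List A} →
  xs ⊆ ys → AllPairs R ys → AllPairs R xs
AllPairs-resp-⊆ []          []          = []
AllPairs-resp-⊆ (_ ∷ʳ xs⊆ys) (_ ∷ incr)  = AllPairs-resp-⊆ xs⊆ys incr
AllPairs-resp-⊆ (refl ∷ xs⊆ys) (y<ys ∷ incr) = All-resp-⊆ xs⊆ys y<ys ∷ AllPairs-resp-⊆ xs⊆ys incr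

pointwise-≥-from-countBelow : ∀ {k} {r r' : Vec ℕ k} →
  AllPairs _<_ (toList r) → AllPairs _<_ (toList r') →
  (∀ x → countBelow x (toList r) ≤ countBelow x (toList r')) → Pointwise _≥_ r r'
pointwise-≥-from-countBelow {r = []} {[]} _ _ _ = []
pointwise-≥-from-countBelow {r = y ∷ ys} {y' ∷ ys'} (y<ys ∷ incr) (y'<ys' ∷ incr') below≤ =
  y'≤y ∷ pointwise-≥-from-countBelow incr incr' tail-below≤
  where
  y'≤y : y' ≤ y
  y'≤y with y <? y'
  ... | no  y≮y' = ≮⇒≥ y≮y'
  ... | yes y<y' = ⊥-elim (n≮0 (subst₂ _≤_ (countBelow-∷-< (n<1+n y))
                      (countBelow-≥ (y<y' ∷ All.map (<-trans y<y') y'<ys')) (below≤ (suc y))))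
  tail-below≤ : ∀ x → countBelow x (toList ys) ≤ countBelow x (toList ys')
  tail-below≤ x with y <? x
  ... | yes y<x = s≤s⁻¹ (subst₂ _≤_ (countBelow-∷-< y<x) (countBelow-∷-< (≤-<-trans y'≤y y<x)) (below≤ x))
  ... | no  y≮x = ≤-trans (≤-reflexive (countBelow-≥ (All.map (λ y<z → <⇒≤ (≤-<-trans (≮⇒≥ y≮x) y<z)) y<ys)))
                           z≤n

pointwise-≥-antisym : ∀ {k} {r r' : Vec ℕ k} → Pointwise _≥_ r r' → Pointwise _≥_ r' r → r ≡ r'
pointwise-≥-antisym []              []              = refl
pointwise-≥-antisym (y≥y' ∷ ys≥ys') (y'≥y ∷ ys'≥ys) =
  cong₂ _∷_ (≤-antisym y'≥y y≥y') (pointwise-≥-antisym ys≥ys' ys'≥ys)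

interval : ℕ → (k : ℕ) → Vec ℕ k
interval s zero    = []
interval s (suc k) = s ∷ interval (suc s) k

applyUpTo-interval : ∀ (f : ℕ → ℕ) s k → (∀ i → f i ≡ s + i) → applyUpTo f k ≡ toList (interval s k)
applyUpTo-interval f s zero    f≗s+ = refl
applyUpTo-interval f s (suc k) f≗s+ = cong₂ _∷_ (trans (f≗s+ 0) (+-identityʳ s))
  (applyUpTo-interval (λ i → f (suc i)) (suc s) k (λ i → trans (f≗s+ (suc i)) (+-suc s i)))

suc-upTo : ∀ n → map suc (upTo n) ≡ toList (interval 1 n)
suc-upTo n = trans (List.map-upTo suc n) (applyUpTo-interval suc 1 n (λ _ → refl))

∈-interval : ∀ {x} s k → x ∈ toList (interval s k) → s ≤ x × x < s + k
∈-interval s (suc k) (here refl) = ≤-refl , ≤-<-trans (m≤m+n s k) (≤-reflexive (sym (+-suc s k)))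
∈-interval s (suc k) (there x∈) with ∈-interval (suc s) k x∈
... | s<x , x<s+k = <⇒≤ s<x , ≤-trans x<s+k (≤-reflexive (sym (+-suc s k)))

interval-increasing : ∀ s k → Linked _<_ (toList (interval s k))
interval-increasing s zero          = []
interval-increasing s (suc zero)    = [-]
interval-increasing s (suc (suc k)) = n<1+n s ∷ interval-increasing (suc s) (suc k)

interval-split : ∀ s j k →
  toList (interval s (j + suc k)) ≡ toList (interval s j) ++ (s + j) ∷ toList (interval (suc (s + j)) k)
interval-split s zero    k rewrite +-identityʳ s = refl
interval-split s (suc j) k rewrite +-suc s j = cong (s ∷_) (interval-split (suc s) j k)

countBelow-interval : ∀ s k i → i ≤ k → countBelow (s + i) (toList (interval s k)) ≡ i
countBelow-interval s k zero _ rewrite +-identityʳ s =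
  countBelow-≥ (All.tabulate (λ x∈ → proj₁ (∈-interval s k x∈)))
countBelow-interval s (suc k) (suc i) (s≤s i≤k) rewrite +-suc s i =
  trans (countBelow-∷-< (s≤s (m≤m+n s i))) (cong suc (countBelow-interval (suc s) k i i≤k))

module _ {n : ℕ} {τ : Filling n} (τ-rst : IsRST n τ) where

  reading-↭-interval : rowReading τ ↭ toList (interval 1 n)
  reading-↭-interval = ↭-trans (proj₁ τ-rst) (↭-reflexive (suc-upTo n))

  row-increasing : AllPairs _<_ (toList (row τ))
  row-increasing = Linked⇒AllPairs <-trans (proj₁ (proj₂ τ-rst))

  entry-bounds : ∀ {x} → x ∈ rowReading τ → 1 ≤ x × x ≤ n
  entry-bounds x∈ with ∈-interval 1 n (∈-resp-↭ reading-↭-interval x∈)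
  ... | 1≤x , x<1+n = 1≤x , s≤s⁻¹ x<1+n

  countBelow-reading : ∀ {i} → i ≤ n → countBelow (suc i) (rowReading τ) ≡ i
  countBelow-reading {i} i≤n = trans (countBelow-↭ reading-↭-interval) (countBelow-interval 1 n i i≤n)

-- The increasing first row has no inversions; b₂ precedes its b₂ − 1 smaller
-- values and b₁ precedes its smaller values other than b₂.
ρ-from-entries : ∀ {n} {τ : Filling n} → IsRST n τ → 3 + ρ τ ≡ b₂ τ + b₁ τ
ρ-from-entries {τ = mkFilling r zero b₂} (_ , _ , ())
ρ-from-entries {τ = mkFilling r (suc j) zero} τ-rst with entry-bounds τ-rst (here refl)
... | () , _
ρ-from-entries {τ = mkFilling r (suc j) (suc i)} τ-rst@(_ , _ , i<j) = begin
  3 + (countBelow (suc i) (suc j ∷ xs) + (c + inv xs)) ≡⟨ cong₂ (λ d e → 3 + (d + e)) below-b₂ (cong (c +_) row-sorted) ⟩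
  3 + (i + (c + 0))                                    ≡⟨ arrange i c ⟩
  suc i + suc (suc c)                                  ≡⟨ cong (λ d → suc i + suc d) below-b₁ ⟩
  suc i + suc j                                        ∎
  where
  open ≡-Reasoning
  xs : List ℕ
  xs = toList r
  c : ℕ
  c = countBelow (suc j) xs
  arrange : ∀ i c → 3 + (i + (c + 0)) ≡ suc i + suc (suc c)
  arrange = solve-∀
  row-sorted : inv xs ≡ 0
  row-sorted = inv-increasing (row-increasing τ-rst)
  below-b₂ : countBelow (suc i) (suc j ∷ xs) ≡ i
  below-b₂ = trans (sym (countBelow-∷-≮ (n≮n (suc i))))
                   (countBelow-reading τ-rst (<⇒≤ (proj₂ (entry-bounds τ-rst (here refl)))))
  below-b₁ : suc c ≡ j
  below-b₁ = begin
    suc c                                  ≡⟨ cong suc (countBelow-∷-≮ (n≮n (suc j))) ⟨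
    suc (countBelow (suc j) (suc j ∷ xs))  ≡⟨ countBelow-∷-< i<j ⟨
    countBelow (suc j) (suc i ∷ suc j ∷ xs) ≡⟨ countBelow-reading τ-rst (<⇒≤ (proj₂ (entry-bounds τ-rst (there (here refl))))) ⟩
    j                                      ∎

ρ-step : ∀ {n} {τ σ : Filling n} → IsRST n τ → IsRST n σ →
  b₂ σ + b₁ σ ≡ suc (b₂ τ + b₁ τ) → ρ σ ≡ ρ τ + 1
ρ-step {τ = τ} {σ} τ-rst σ-rst sum≡ = +-cancelˡ-≡ 3 (ρ σ) (ρ τ + 1) (begin
  3 + ρ σ             ≡⟨ ρ-from-entries σ-rst ⟩
  b₂ σ + b₁ σ         ≡⟨ sum≡ ⟩
  suc (b₂ τ + b₁ τ)   ≡⟨ cong suc (ρ-from-entries τ-rst) ⟨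
  suc (3 + ρ τ)       ≡⟨ cong (3 +_) (+-comm 1 (ρ τ)) ⟩
  3 + (ρ τ + 1)       ∎)
  where open ≡-Reasoning

-- Both readings are permutations of 1,…,n, so the rows share the counts of
-- the whole reading, minus the (antitone) contributions of b₂ and b₁.
⊑-from-entries : ∀ {n} {τ σ : Filling n} → IsRST n τ → IsRST n σ →
  b₁ τ ≤ b₁ σ → b₂ τ ≤ b₂ σ → τ ⊑ σ
⊑-from-entries {τ = τ} {σ} τ-rst σ-rst b₁≤ b₂≤ =
  pointwise-≥-from-countBelow (row-increasing τ-rst) (row-increasing σ-rst) row-below≤ , b₁≤ , b₂≤
  where
  row-below≤ : ∀ x → countBelow x (toList (row τ)) ≤ countBelow x (toList (row σ))
  row-below≤ x = +-cancelˡ-≤ (countBelow x (b₂ σ ∷ [ b₁ σ ])) _ _ (begin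
    countBelow x (b₂ σ ∷ [ b₁ σ ]) + countBelow x (toList (row τ))
      ≤⟨ +-monoˡ-≤ _ (countBelow-antitone {x} (b₂≤ ∷ b₁≤ ∷ [])) ⟩
    countBelow x (b₂ τ ∷ [ b₁ τ ]) + countBelow x (toList (row τ))
      ≡⟨ countBelow-++ x (b₂ τ ∷ [ b₁ τ ]) (toList (row τ)) ⟨
    countBelow x (rowReading τ)
      ≡⟨ countBelow-↭ {x} (↭-trans (reading-↭-interval τ-rst) (↭-sym (reading-↭-interval σ-rst))) ⟩
    countBelow x (rowReading σ)
      ≡⟨ countBelow-++ x (b₂ σ ∷ [ b₁ σ ]) (toList (row σ)) ⟩
    countBelow x (b₂ σ ∷ [ b₁ σ ]) + countBelow x (toList (row σ)) ∎)
    where open ≤-Reasoning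

≡-from-entries : ∀ {n} {τ σ : Filling n} → IsRST n τ → IsRST n σ →
  b₁ τ ≡ b₁ σ → b₂ τ ≡ b₂ σ → τ ≡ σ
≡-from-entries {τ = mkFilling r b₁ b₂} {mkFilling r' _ _} τ-rst σ-rst refl refl =
  cong (λ r → mkFilling r b₁ b₂) (pointwise-≥-antisym
    (proj₁ (⊑-from-entries τ-rst σ-rst ≤-refl ≤-refl))
    (proj₁ (⊑-from-entries σ-rst τ-rst ≤-refl ≤-refl)))

gapFilling : ∀ p q r → Filling (2 + (p + q + r))
gapFilling p q r =
  mkFilling ((interval 1 p Vec.++ interval (2 + p) q) Vec.++ interval (3 + (p + q)) r) (2 + (p + q)) (1 + p)

gapFilling-rst : ∀ p q r → IsRST (2 + (p + q + r)) (gapFilling p q r)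
gapFilling-rst p q r = reading↭ , AllPairs⇒Linked row-incr , s≤s (s≤s (m≤m+n p q))
  where
  n = 2 + (p + q + r)
  a = 1 + p
  b = 2 + (p + q)
  A = toList (interval 1 p)
  B = toList (interval (2 + p) q)
  C = toList (interval (3 + (p + q)) r)
  row-list : toList (row (gapFilling p q r)) ≡ A ++ (B ++ C)
  row-list = begin
    toList ((interval 1 p Vec.++ interval (2 + p) q) Vec.++ interval (3 + (p + q)) r)
      ≡⟨ Vec.toList-++ (interval 1 p Vec.++ interval (2 + p) q) (interval (3 + (p + q)) r) ⟩
    toList (interval 1 p Vec.++ interval (2 + p) q) ++ C
      ≡⟨ cong (_++ C) (Vec.toList-++ (interval 1 p) (interval (2 + p) q)) ⟩
    (A ++ B) ++ C
      ≡⟨ List.++-assoc A B C ⟩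
    A ++ (B ++ C) ∎
    where open ≡-Reasoning
  full-list : toList (interval 1 n) ≡ A ++ a ∷ (B ++ b ∷ C)
  full-list = begin
    toList (interval 1 n)                          ≡⟨ cong (λ k → toList (interval 1 k)) (size p q r) ⟩
    toList (interval 1 (p + suc (q + suc r)))      ≡⟨ interval-split 1 p (q + suc r) ⟩
    A ++ a ∷ toList (interval (2 + p) (q + suc r)) ≡⟨ cong (λ xs → A ++ a ∷ xs) (interval-split (2 + p) q r) ⟩
    A ++ a ∷ (B ++ b ∷ C)                          ∎
    where
    open ≡-Reasoning
    size : ∀ p q r → 2 + (p + q + r) ≡ p + suc (q + suc r)
    size = solve-∀
  reading↭ : a ∷ b ∷ toList (row (gapFilling p q r)) ↭ map suc (upTo n)
  reading↭ = begin
    a ∷ b ∷ toList (row (gapFilling p q r)) ≡⟨ cong (λ xs → a ∷ b ∷ xs) row-list ⟩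
    a ∷ b ∷ A ++ (B ++ C)                   ↭⟨ prep a (shift b A (B ++ C)) ⟨
    a ∷ A ++ b ∷ (B ++ C)                   ↭⟨ ++⁺ˡ (a ∷ A) (shift b B C) ⟨
    a ∷ A ++ (B ++ b ∷ C)                   ↭⟨ shift a A (B ++ b ∷ C) ⟨
    A ++ a ∷ (B ++ b ∷ C)                   ≡⟨ trans (suc-upTo n) full-list ⟨
    map suc (upTo n)                        ∎
    where open PermutationReasoning
  row-incr : AllPairs _<_ (toList (row (gapFilling p q r)))
  row-incr rewrite row-list = AllPairs-resp-⊆ (++⁺ ⊆-refl (a ∷ʳ ++⁺ ⊆-refl (b ∷ʳ ⊆-refl)))
    (subst (AllPairs _<_) full-list (Linked⇒AllPairs <-trans (interval-increasing 1 n)))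

tableau-with-entries : ∀ {n a b} → 1 ≤ a → a < b → b ≤ n →
  Σ (Filling n) λ σ → IsRST n σ × b₂ σ ≡ a × b₁ σ ≡ b
tableau-with-entries 1≤a a<b b≤n
  with m≤n⇒∃[o]m+o≡n 1≤a | m≤n⇒∃[o]m+o≡n a<b | m≤n⇒∃[o]m+o≡n b≤n
... | p , refl | q , refl | r , refl = gapFilling p q r , gapFilling-rst p q r , refl , refl

raise-entry : ∀ {n a b} {τ τ' : Filling n} → IsRST n τ → IsRST n τ' →
  b₂ τ ≤ a → b₁ τ ≤ b → a ≤ b₂ τ' → b ≤ b₁ τ' → a < b → a + b ≡ suc (b₂ τ + b₁ τ) →
  Σ (Filling n) λ σ → IsRST n σ × τ ⊏ σ × σ ⊑ τ' × ρ σ ≡ ρ τ + 1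
raise-entry {τ = τ} τ-rst τ'-rst b₂≤a b₁≤b a≤b₂' b≤b₁' a<b sum≡
  with tableau-with-entries (≤-trans (proj₁ (entry-bounds τ-rst (here refl))) b₂≤a) a<b
         (≤-trans b≤b₁' (proj₂ (entry-bounds τ'-rst (there (here refl)))))
... | σ , σ-rst , refl , refl =
  σ , σ-rst , (⊑-from-entries τ-rst σ-rst b₁≤b b₂≤a , τ≢σ) ,
  ⊑-from-entries σ-rst τ'-rst b≤b₁' a≤b₂' , ρ-step τ-rst σ-rst sum≡
  where
  τ≢σ : ¬ τ ≡ σ
  τ≢σ τ≡σ = 1+n≢n (trans (sym sum≡) (sym (cong (λ υ → b₂ υ + b₁ υ) τ≡σ)))

cover-step : ∀ {n} {τ τ' : Filling n} → IsRST n τ → IsRST n τ' → τ ⊏ τ' →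
  Σ (Filling n) λ σ → IsRST n σ × τ ⊏ σ × σ ⊑ τ' × ρ σ ≡ ρ τ + 1
cover-step {τ = τ} {τ'} τ-rst τ'-rst ((_ , b₁≤ , b₂≤) , τ≢τ')
  with m≤n⇒m<n∨m≡n b₁≤ | m≤n⇒m<n∨m≡n b₂≤
... | inj₁ b₁< | _ =
  raise-entry τ-rst τ'-rst ≤-refl (n≤1+n _) b₂≤ b₁<
    (m<n⇒m<1+n (proj₂ (proj₂ τ-rst))) (+-suc (b₂ τ) (b₁ τ))
... | inj₂ b₁≡ | inj₁ b₂< =
  raise-entry τ-rst τ'-rst (n≤1+n _) ≤-refl b₂< (≤-reflexive b₁≡)
    (≤-<-trans b₂< (subst (b₂ τ' <_) (sym b₁≡) (proj₂ (proj₂ τ'-rst)))) refl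
... | inj₂ b₁≡ | inj₂ b₂≡ = ⊥-elim (τ≢τ' (≡-from-entries τ-rst τ'-rst b₁≡ b₂≡))

-- σ ⊑ τ' cannot be strict since τ' covers τ; as equality of ranks is
-- decidable, refuting ρ σ ≢ ρ τ' is enough.
ρ-cover : ∀ {n} (τ τ' : Filling n) → IsRST n τ → IsRST n τ' → Covers n τ τ' → ρ τ' ≡ ρ τ + 1
ρ-cover τ τ' τ-rst τ'-rst (τ⊏τ' , nothing-between) with cover-step τ-rst τ'-rst τ⊏τ'
... | σ , σ-rst , τ⊏σ , σ⊑τ' , ρσ≡ = trans (sym ρσ≡ρτ') ρσ≡
  where
  ρσ≡ρτ' : ρ σ ≡ ρ τ'
  ρσ≡ρτ' = decidable-stable (ρ σ ≟ ρ τ')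
    (λ ρσ≢ρτ' → nothing-between (σ , σ-rst , τ⊏σ , σ⊑τ' , λ σ≡τ' → ρσ≢ρτ' (cong ρ σ≡τ')))

extreme-entry-sum : ∀ m → suc m + suc (suc m) ≡ 3 + 2 * m
extreme-entry-sum = solve-∀

least-tableau : ∀ m → Σ (Filling (2 + m)) λ τ₀ → IsRST (2 + m) τ₀ ×
  ((τ : Filling (2 + m)) → IsRST (2 + m) τ → τ₀ ⊑ τ) × ρ τ₀ ≡ 0
least-tableau m = gapFilling 0 0 m , τ₀-rst , τ₀-⊑ , +-cancelˡ-≡ 3 _ 0 (ρ-from-entries τ₀-rst)
  where
  τ₀-rst : IsRST (2 + m) (gapFilling 0 0 m)
  τ₀-rst = gapFilling-rst 0 0 m
  τ₀-⊑ : (τ : Filling (2 + m)) → IsRST (2 + m) τ → gapFilling 0 0 m ⊑ τ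
  τ₀-⊑ τ τ-rst = ⊑-from-entries τ₀-rst τ-rst (≤-trans (s≤s 1≤b₂) (proj₂ (proj₂ τ-rst))) 1≤b₂
    where
    1≤b₂ : 1 ≤ b₂ τ
    1≤b₂ = proj₁ (entry-bounds τ-rst (here refl))

greatest-rank : ∀ m → Σ (Filling (2 + m)) λ τ → IsRST (2 + m) τ × ρ τ ≡ 2 * m
greatest-rank m with tableau-with-entries (s≤s z≤n) ≤-refl ≤-refl
... | τ , τ-rst , refl , refl =
  τ , τ-rst , +-cancelˡ-≡ 3 _ _ (trans (ρ-from-entries τ-rst) (extreme-entry-sum m))

ρ-≤-rank : ∀ m (τ : Filling (2 + m)) → IsRST (2 + m) τ → ρ τ ≤ 2 * m
ρ-≤-rank m τ τ-rst = +-cancelˡ-≤ 3 _ _ (begin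
  3 + ρ τ             ≡⟨ ρ-from-entries τ-rst ⟩
  b₂ τ + b₁ τ         ≤⟨ +-mono-≤ (s≤s⁻¹ (≤-trans (proj₂ (proj₂ τ-rst)) b₁≤n)) b₁≤n ⟩
  suc m + suc (suc m) ≡⟨ extreme-entry-sum m ⟩
  3 + 2 * m           ∎)
  where
  open ≤-Reasoning
  b₁≤n : b₁ τ ≤ 2 + m
  b₁≤n = proj₂ (entry-bounds τ-rst (there (here refl)))

theorem4p7 : (n : ℕ) → 4 ≤ n →
    (Σ (Filling n) λ τ₀ → IsRST n τ₀ ×
        ((τ : Filling n) → IsRST n τ → τ₀ ⊑ τ) × ρ τ₀ ≡ 0) ×
    ((τ τ' : Filling n) → IsRST n τ → IsRST n τ' →
        Covers n τ τ' → ρ τ' ≡ ρ τ + 1) ×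
    (Σ (Filling n) λ τ → IsRST n τ × ρ τ ≡ 2 * (n ∸ 2)) ×
    ((τ : Filling n) → IsRST n τ → ρ τ ≤ 2 * (n ∸ 2))
theorem4p7 (suc (suc m)) (s≤s (s≤s _)) = least-tableau m , ρ-cover , greatest-rank m , ρ-≤-rank m
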